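{- Let $n\ge 4$ and $2\le r\le n+1$, and let $S$ be a subgraph of $FQ_n$ isomorphic to the star $K_{1,r}$. If $u$ is a vertex of $FQ_n$ not in $V(S)$, then $|N_{FQ_n}(u)\cap V(S)|\le 2$, with equality if and only if $u$ is adjacent to exactly two leaves of $S$.
   Context: The $n$-dimensional hypercube $Q_n$ has as vertices all binary strings of length $n$, two strings being adjacent iff they differ in exactly one position. The folded hypercube $FQ_n$ is obtained from $Q_n$ by adding, for every vertex $u=u_1\cdots u_n$, the edge between $u$ and its complement $\bar u=\bar u_1\cdots\bar u_n$ (where $\bar u_i=1-u_i$). $K_{1,r}$ denotes the star with $r$ leaves; $N_G(u)$ is the set of neighbors of $u$ in $G$. -}

module Defs where

open import Data.Nat using (ℕ; zero; suc; _+_)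
open import Data.Bool using (Bool; true; false; not)
import Data.Bool.Properties as BoolP
open import Data.Vec using (Vec; []; _∷_; map)
import Data.Vec.Properties as VecP
open import Data.Fin using (Fin)
import Data.Fin as Fin
open import Data.Sum using (_⊎_)
open import Data.Product using (Σ)
open import Relation.Nullary using (Dec; yes; no)
open import Relation.Nullary.Decidable using (_⊎-dec_)
open import Relation.Binary.PropositionalEquality using (_≡_)
import Data.Nat.Properties as NatP

Vertex : ℕ → Set
Vertex n = Vec Bool n

hamming : ∀ {n} → Vertex n → Vertex n → ℕ
hamming []       []       = 0
hamming (x ∷ xs) (y ∷ ys) with x BoolP.≟ y
... | yes _ = hamming xs ys
... | no  _ = suc (hamming xs ys)

complement : ∀ {n} → Vertex n → Vertex n
complement = map not

FQAdj : ∀ {n} → Vertex n → Vertex n → Set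
FQAdj u v = (hamming u v ≡ 1) ⊎ (v ≡ complement u)

FQAdj? : ∀ {n} (u v : Vertex n) → Dec (FQAdj u v)
FQAdj? u v = (hamming u v NatP.≟ 1) ⊎-dec VecP.≡-dec BoolP._≟_ v (complement u)

countFin : ∀ {r} (P : Fin r → Set) → (∀ i → Dec (P i)) → ℕ
countFin {zero}  P P? = 0
countFin {suc r} P P? with P? Fin.zero
... | yes _ = suc (countFin (λ i → P (Fin.suc i)) (λ i → P? (Fin.suc i)))
... | no  _ = countFin (λ i → P (Fin.suc i)) (λ i → P? (Fin.suc i))

record Star (n r : ℕ) : Set where
  field
    center     : Vertex n
    leaf       : Fin r → Vertex n
    leaf-inj   : ∀ i j → leaf i ≡ leaf j → i ≡ j
    leaf-adj   : ∀ i → FQAdj center (leaf i)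

open Star public

InStar : ∀ {n r} → Star n r → Vertex n → Set
InStar {r = r} S u = (u ≡ center S) ⊎ (Σ (Fin r) λ i → u ≡ leaf S i)

adjLeaves : ∀ {n r} → Star n r → Vertex n → ℕ
adjLeaves S u = countFin (λ i → FQAdj u (leaf S i)) (λ i → FQAdj? u (leaf S i))

-- |N_{FQ_n}(u) ∩ V(S)|  (leaves are distinct and differ from the center).
nbrsInStar : ∀ {n r} → Star n r → Vertex n → ℕ
nbrsInStar S u with FQAdj? u (center S)
... | yes _ = suc (adjLeaves S u)
... | no  _ = adjLeaves S u

-- FQ_n is the Cayley graph of (ℤ₂)ⁿ whose generators are the unit vectors e₁, …, eₙ and the
-- all-ones vector 𝟙, so a path u ~ v ~ w gives w = u + g + h for generators g, h.  For n ≥ 3 a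
-- sum of two generators is never a generator (the weights 0, 2, n - 1 avoid 1 and n), so FQ_n
-- is triangle-free and a neighbour of the centre of S sees no leaf.  For n ≥ 4 a nonzero sum
-- g + h determines the pair {g, h} (now also n - 1 ≠ 2), so two distinct vertices u, v have at
-- most two common neighbours, namely u + g and u + h.  If u is not adjacent to the centre, its
-- neighbours in S are leaves, hence common neighbours of u and the centre.
module Submission where

open import Defs
open import Data.Bool using (Bool; true; false; not; _xor_)
import Data.Bool.Properties as Bool
open import Data.Empty using (⊥-elim)
open import Data.Fin using (Fin; zero; suc)
open import Data.Fin.Properties using (_≟_; ¬∀⟶∃¬; pigeonhole; <⇒≢; suc-injective)
open import Data.List using (List; []; _∷_; length; lookup)
open import Data.List.Membership.Propositional using (_∈_)
open import Data.List.Relation.Unary.All using (All; []; _∷_)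
open import Data.List.Relation.Unary.All.Properties using (¬Any⇒All¬)
open import Data.List.Relation.Unary.Any using (index; any?)
open import Data.List.Relation.Unary.Any.Properties using (lookup-index)
open import Data.Maybe using (Maybe; just; nothing)
import Data.Maybe.Properties as Maybe
open import Data.Nat using (ℕ; zero; suc; _≤_; _<_; _+_; s≤s; z≤n; pred)
open import Data.Nat.Properties using (<⇒≤; ≤-reflexive)
open import Data.Product using (_×_; _,_; ∃-syntax)
open import Data.Sum using (_⊎_; inj₁; inj₂)
import Data.Sum as Sum
open import Data.Vec using (Vec; []; _∷_)
import Data.Vec as Vec
open import Data.Vec.Properties using (lookup-map; tabulate∘lookup; tabulate-cong)
open import Function using (_∘_; id; case_of_)
open import Function.Bundles using (_⇔_; mk⇔)
open import Relation.Nullary using (¬_; Dec; yes; no; does)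
open import Relation.Nullary.Decidable using (dec-true; dec-false)
open import Relation.Binary.PropositionalEquality
  using (_≡_; _≢_; _≗_; refl; sym; trans; cong; cong₂; module ≡-Reasoning)

private
  variable
    n : ℕ

xor-involutiveˡ : ∀ x y → x xor (x xor y) ≡ y
xor-involutiveˡ x y = trans (sym (Bool.xor-assoc x x y)) (cong (_xor y) (Bool.xor-same x))

xor-involutiveʳ : ∀ x y → (x xor y) xor y ≡ x
xor-involutiveʳ x y =
  trans (Bool.xor-assoc x y y) (trans (cong (x xor_) (Bool.xor-same y)) (Bool.xor-identityʳ x))

xor-cancelˡ : ∀ x {y z} → x xor y ≡ x xor z → y ≡ z
xor-cancelˡ x {y} {z} eq = begin
  y                 ≡⟨ sym (xor-involutiveˡ x y) ⟩
  x xor (x xor y)   ≡⟨ cong (x xor_) eq ⟩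
  x xor (x xor z)   ≡⟨ xor-involutiveˡ x z ⟩
  z                 ∎
  where open ≡-Reasoning

xor-true : ∀ x → x xor true ≡ not x
xor-true x = trans (Bool.xor-comm x true) (Bool.true-xor x)

≗-lookup⇒≡ : {A : Set} {u v : Vec A n} → Vec.lookup u ≗ Vec.lookup v → u ≡ v
≗-lookup⇒≡ {u = u} {v} eq =
  trans (sym (tabulate∘lookup u)) (trans (tabulate-cong eq) (tabulate∘lookup v))

short-list-not-covering : (xs : List (Fin n)) → length xs < n → ¬ (∀ k → k ∈ xs)
short-list-not-covering xs len<n covering
  with i , j , i<j , same-index ← pigeonhole len<n (index ∘ covering)
  = <⇒≢ i<j (trans (lookup-index (covering i))
              (trans (cong (lookup xs) same-index) (sym (lookup-index (covering j)))))

fresh : (xs : List (Fin n)) → length xs < n → ∃[ k ] All (k ≢_) xs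
fresh {n} xs len<n
  with k , k∉xs ← ¬∀⟶∃¬ n (_∈ xs) (λ k → any? (k ≟_) xs) (short-list-not-covering xs len<n)
  = k , ¬Any⇒All¬ xs k∉xs

-- Points of (ℤ₂)ⁿ are read as functions Fin n → Bool; `just i` encodes eᵢ and `nothing` 𝟙.
Generator : ℕ → Set
Generator n = Maybe (Fin n)

bit : Generator n → Fin n → Bool
bit (just i) k = does (i ≟ k)
bit nothing  k = true

_⊕_ : (f g : Fin n → Bool) → Fin n → Bool
(f ⊕ g) k = f k xor g k

infixl 6 _⊕_

⊕-cancelˡ : {f g h : Fin n → Bool} → f ⊕ g ≗ f ⊕ h → g ≗ h
⊕-cancelˡ {f = f} eq k = xor-cancelˡ (f k) (eq k)

⊕-comm : (f g : Fin n → Bool) → f ⊕ g ≗ g ⊕ f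
⊕-comm f g k = Bool.xor-comm (f k) (g k)

bit-on : (i : Fin n) → bit (just i) i ≡ true
bit-on i = dec-true (i ≟ i) refl

bit-off : {i k : Fin n} → k ≢ i → bit (just i) k ≡ false
bit-off {i = i} {k} k≢i = dec-false (i ≟ k) (k≢i ∘ sym)

≗-at : {f g : Fin n → Bool} {x y : Bool} → f ≗ g → ∀ k → f k ≡ x → g k ≡ y → x ≡ y
≗-at f≗g k fk≡x gk≡y = trans (sym fk≡x) (trans (f≗g k) gk≡y)

𝟙⊕e-not-generator : 3 ≤ n → (j : Fin n) (c : Generator n) → ¬ (bit nothing ⊕ bit (just j) ≗ bit c)
𝟙⊕e-not-generator _ j nothing E = case ≗-at E j (cong₂ _xor_ refl (bit-on j)) refl of λ ()
𝟙⊕e-not-generator 3≤n j (just p) E with m , m≢j ∷ m≢p ∷ [] ← fresh (j ∷ p ∷ []) 3≤n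
  = case ≗-at E m (cong₂ _xor_ refl (bit-off m≢j)) (bit-off m≢p) of λ ()

generator-sum-not-generator : 3 ≤ n → (a b c : Generator n) → ¬ (bit a ⊕ bit b ≗ bit c)
generator-sum-not-generator (s≤s _) nothing nothing nothing E = case E zero of λ ()
generator-sum-not-generator _ nothing nothing (just p) E =
  case ≗-at E p refl (bit-on p) of λ ()
generator-sum-not-generator 3≤n nothing (just j) c E = 𝟙⊕e-not-generator 3≤n j c E
generator-sum-not-generator 3≤n (just i) nothing c E =
  𝟙⊕e-not-generator 3≤n i c (λ k → trans (⊕-comm (bit nothing) (bit (just i)) k) (E k))
generator-sum-not-generator 3≤n (just i) (just j) nothing E
  with m , m≢i ∷ m≢j ∷ [] ← fresh (i ∷ j ∷ []) 3≤n
  = case ≗-at E m (cong₂ _xor_ (bit-off m≢i) (bit-off m≢j)) refl of λ ()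
generator-sum-not-generator _ (just i) (just j) (just p) E with i ≟ j | p ≟ i
... | yes refl | _       = case ≗-at E p (Bool.xor-same (bit (just i) p)) (bit-on p) of λ ()
... | no i≢j   | yes refl =
  case ≗-at E j (cong₂ _xor_ (bit-off (i≢j ∘ sym)) (bit-on j)) (bit-off (i≢j ∘ sym)) of λ ()
... | no i≢j   | no p≢i   =
  case ≗-at E i (cong₂ _xor_ (bit-on i) (bit-off i≢j)) (bit-off (p≢i ∘ sym)) of λ ()

_≟ᵍ_ : (a b : Generator n) → Dec (a ≡ b)
_≟ᵍ_ = Maybe.≡-dec _≟_

𝟙⊕e-not-other-sum : 3 < n → (j p : Fin n) (d : Generator n) → p ≢ j →
                    ¬ (bit nothing ⊕ bit (just j) ≗ bit (just p) ⊕ bit d)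
𝟙⊕e-not-other-sum _ j p nothing p≢j E =
  case ≗-at E p (cong₂ _xor_ refl (bit-off p≢j)) (cong₂ _xor_ (bit-on p) refl) of λ ()
𝟙⊕e-not-other-sum 3<n j p (just q) _ E
  with m , m≢j ∷ m≢p ∷ m≢q ∷ [] ← fresh (j ∷ p ∷ q ∷ []) 3<n
  = case ≗-at E m (cong₂ _xor_ refl (bit-off m≢j)) (cong₂ _xor_ (bit-off m≢p) (bit-off m≢q)) of λ ()

generator-sums-differ : 3 < n → (a b c d : Generator n) → a ≢ b → c ≢ a → c ≢ b →
                        ¬ (bit a ⊕ bit b ≗ bit c ⊕ bit d)
generator-sums-differ _ nothing nothing _ _ a≢b _ _ _ = a≢b refl
generator-sums-differ _ nothing _ nothing _ _ c≢a _ _ = c≢a refl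
generator-sums-differ _ (just i) nothing nothing _ _ _ c≢b _ = c≢b refl
generator-sums-differ 3<n nothing (just j) (just p) d _ _ c≢b E =
  𝟙⊕e-not-other-sum 3<n j p d (c≢b ∘ cong just) E
generator-sums-differ 3<n (just i) nothing (just p) d _ c≢a _ E =
  𝟙⊕e-not-other-sum 3<n i p d (c≢a ∘ cong just)
    (λ k → trans (⊕-comm (bit nothing) (bit (just i)) k) (E k))
generator-sums-differ _ (just i) (just j) nothing nothing a≢b _ _ E =
  case ≗-at E i (cong₂ _xor_ (bit-on i) (bit-off (a≢b ∘ cong just))) refl of λ ()
generator-sums-differ 3<n (just i) (just j) nothing (just q) _ _ _ E
  with m , m≢i ∷ m≢j ∷ m≢q ∷ [] ← fresh (i ∷ j ∷ q ∷ []) 3<n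
  = case ≗-at E m (cong₂ _xor_ (bit-off m≢i) (bit-off m≢j)) (cong₂ _xor_ refl (bit-off m≢q))
    of λ ()
generator-sums-differ 3<n (just i) (just j) (just p) nothing _ _ _ E
  with m , m≢i ∷ m≢j ∷ m≢p ∷ [] ← fresh (i ∷ j ∷ p ∷ []) 3<n
  = case ≗-at E m (cong₂ _xor_ (bit-off m≢i) (bit-off m≢j)) (cong₂ _xor_ (bit-off m≢p) refl)
    of λ ()
generator-sums-differ _ (just i) (just j) (just p) (just q) a≢b c≢a c≢b E with q ≟ p
... | yes refl =
  case ≗-at E i (cong₂ _xor_ (bit-on i) (bit-off i≢j)) (cong₂ _xor_ (bit-off i≢p) (bit-off i≢p))
    of λ ()
  where i≢j = a≢b ∘ cong just
        i≢p = c≢a ∘ cong just ∘ sym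
... | no q≢p   =
  case ≗-at E p (cong₂ _xor_ (bit-off p≢i) (bit-off p≢j)) (cong₂ _xor_ (bit-on p) (bit-off (q≢p ∘ sym)))
    of λ ()
  where p≢i = c≢a ∘ cong just
        p≢j = c≢b ∘ cong just

generator-pair-unique : 3 < n → {a b c d : Generator n} → a ≢ b →
                        bit a ⊕ bit b ≗ bit c ⊕ bit d → c ≡ a ⊎ c ≡ b
generator-pair-unique 3<n {a} {b} {c} {d} a≢b E with c ≟ᵍ a | c ≟ᵍ b
... | yes c≡a | _       = inj₁ c≡a
... | no _    | yes c≡b = inj₂ c≡b
... | no c≢a  | no c≢b  = ⊥-elim (generator-sums-differ 3<n a b c d a≢b c≢a c≢b E)

record Translate (g : Generator n) (u v : Vertex n) : Set where
  constructor translation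
  field flips : Vec.lookup v ≗ Vec.lookup u ⊕ bit g

open Translate

translate-sym : {g : Generator n} {u v : Vertex n} → Translate g u v → Translate g v u
translate-sym {g = g} {u} T = translation λ k →
  sym (trans (cong (_xor bit g k) (flips T k)) (xor-involutiveʳ (Vec.lookup u k) (bit g k)))

translate-unique : {g : Generator n} {u v w : Vertex n} → Translate g u v → Translate g u w → v ≡ w
translate-unique Tv Tw = ≗-lookup⇒≡ (λ k → trans (flips Tv k) (sym (flips Tw k)))

translate-trans : {s t : Generator n} {u v w : Vertex n} → Translate s u v → Translate t v w →
                  Vec.lookup w ≗ Vec.lookup u ⊕ (bit s ⊕ bit t)
translate-trans {s = s} {t} {u} Ts Tt k =
  trans (flips Tt k)
        (trans (cong (_xor bit t k) (flips Ts k)) (Bool.xor-assoc (Vec.lookup u k) (bit s k) (bit t k)))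

hamming≡0⇒≡ : (u v : Vertex n) → hamming u v ≡ 0 → u ≡ v
hamming≡0⇒≡ [] [] _ = refl
hamming≡0⇒≡ (x ∷ xs) (y ∷ ys) h with x Bool.≟ y
... | yes refl = cong (x ∷_) (hamming≡0⇒≡ xs ys h)
... | no _     = case h of λ ()

hamming≡1⇒translate : (u v : Vertex n) → hamming u v ≡ 1 → ∃[ i ] Translate (just i) u v
hamming≡1⇒translate [] [] ()
hamming≡1⇒translate (x ∷ xs) (y ∷ ys) h with x Bool.≟ y
... | yes refl with i , T ← hamming≡1⇒translate xs ys h
  = suc i , translation λ { zero → sym (Bool.xor-identityʳ x) ; (suc k) → flips T k }
... | no x≢y with refl ← hamming≡0⇒≡ xs ys (cong pred h)
  = zero , translation λ { zero → trans (Bool.¬-not (x≢y ∘ sym)) (sym (xor-true x))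
                         ; (suc k) → sym (Bool.xor-identityʳ _) }

fqAdj⇒translate : {u v : Vertex n} → FQAdj u v → ∃[ g ] Translate g u v
fqAdj⇒translate {u = u} {v} (inj₁ h) = let i , T = hamming≡1⇒translate u v h in just i , T
fqAdj⇒translate {u = u} (inj₂ refl) =
  nothing , translation λ k → trans (lookup-map k not u) (sym (xor-true _))

triangle-free : 3 ≤ n → {u v w : Vertex n} → FQAdj u v → FQAdj v w → ¬ FQAdj u w
triangle-free 3≤n {u} u~v v~w u~w
  with s , Ts ← fqAdj⇒translate u~v | t , Tt ← fqAdj⇒translate v~w | s′ , Ts′ ← fqAdj⇒translate u~w
  = generator-sum-not-generator 3≤n s t s′
      (⊕-cancelˡ {f = Vec.lookup u} (λ k → trans (sym (translate-trans Ts Tt k)) (flips Ts′ k)))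

common-neighbour-sum : {g g′ : Generator n} {u v x : Vertex n} → Translate g u x → Translate g′ v x →
                       Vec.lookup v ≗ Vec.lookup u ⊕ (bit g ⊕ bit g′)
common-neighbour-sum Tg Tg′ = translate-trans Tg (translate-sym Tg′)

common-neighbour-generators-differ : {g g′ : Generator n} {u v x : Vertex n} → u ≢ v →
                                     Translate g u x → Translate g′ v x → g ≢ g′
common-neighbour-generators-differ {g = g} {u = u} {v} u≢v Tg Tg′ refl = u≢v (≗-lookup⇒≡ u≗v)
  where
  u≗v : Vec.lookup u ≗ Vec.lookup v
  u≗v k = sym (begin
    Vec.lookup v k                           ≡⟨ common-neighbour-sum Tg Tg′ k ⟩
    Vec.lookup u k xor (bit g k xor bit g k) ≡⟨ cong (Vec.lookup u k xor_) (Bool.xor-same (bit g k)) ⟩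
    Vec.lookup u k xor false                 ≡⟨ Bool.xor-identityʳ _ ⟩
    Vec.lookup u k                           ∎)
    where open ≡-Reasoning

common-neighbours-same-sum : {a a′ b b′ : Generator n} {u v x y : Vertex n} →
                             Translate a u x → Translate a′ v x → Translate b u y → Translate b′ v y →
                             bit a ⊕ bit a′ ≗ bit b ⊕ bit b′
common-neighbours-same-sum {u = u} Ta Ta′ Tb Tb′ =
  ⊕-cancelˡ {f = Vec.lookup u}
    (λ k → trans (sym (common-neighbour-sum Ta Ta′ k)) (common-neighbour-sum Tb Tb′ k))

at-most-two-common-neighbours : 3 < n → {u v x y z : Vertex n} → u ≢ v →
  FQAdj u x → FQAdj v x → FQAdj u y → FQAdj v y → FQAdj u z → FQAdj v z →
  x ≡ y ⊎ x ≡ z ⊎ y ≡ z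
at-most-two-common-neighbours 3<n u≢v u~x v~x u~y v~y u~z v~z
  with a , Ta ← fqAdj⇒translate u~x | a′ , Ta′ ← fqAdj⇒translate v~x
     | b , Tb ← fqAdj⇒translate u~y | b′ , Tb′ ← fqAdj⇒translate v~y
     | c , Tc ← fqAdj⇒translate u~z | c′ , Tc′ ← fqAdj⇒translate v~z
  with a≢a′ ← common-neighbour-generators-differ u≢v Ta Ta′
  with generator-pair-unique 3<n {c = b} {b′} a≢a′ (common-neighbours-same-sum Ta Ta′ Tb Tb′)
     | generator-pair-unique 3<n {c = c} {c′} a≢a′ (common-neighbours-same-sum Ta Ta′ Tc Tc′)
... | inj₁ refl | _         = inj₁ (translate-unique Ta Tb)
... | inj₂ _    | inj₁ refl = inj₂ (inj₁ (translate-unique Ta Tc))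
... | inj₂ refl | inj₂ refl = inj₂ (inj₂ (translate-unique Tb Tc))

countFin-none : ∀ {r} (P : Fin r → Set) (P? : ∀ i → Dec (P i)) → (∀ i → ¬ P i) → countFin P P? ≡ 0
countFin-none {zero}  _ _  _  = refl
countFin-none {suc r} P P? ¬P with P? zero
... | yes p = ⊥-elim (¬P zero p)
... | no _  = countFin-none (P ∘ suc) (P? ∘ suc) (¬P ∘ suc)

countFin-≤1 : ∀ {r} (P : Fin r → Set) (P? : ∀ i → Dec (P i)) →
              (∀ i j → P i → P j → i ≡ j) → countFin P P? ≤ 1
countFin-≤1 {zero}  _ _  _ = z≤n
countFin-≤1 {suc r} P P? unique with P? zero
... | yes p = s≤s (≤-reflexive (countFin-none (P ∘ suc) (P? ∘ suc) λ i q →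
                    case unique zero (suc i) p q of λ ()))
... | no _  = countFin-≤1 (P ∘ suc) (P? ∘ suc) (λ i j p q → suc-injective (unique (suc i) (suc j) p q))

countFin-≤2 : ∀ {r} (P : Fin r → Set) (P? : ∀ i → Dec (P i)) →
              (∀ i j k → P i → P j → P k → i ≡ j ⊎ i ≡ k ⊎ j ≡ k) → countFin P P? ≤ 2
countFin-≤2 {zero}  _ _  _ = z≤n
countFin-≤2 {suc r} P P? no-three with P? zero
... | yes p = s≤s (countFin-≤1 (P ∘ suc) (P? ∘ suc) λ i j q q′ →
                    case no-three zero (suc i) (suc j) p q q′ of λ
                      { (inj₁ ()) ; (inj₂ (inj₁ ())) ; (inj₂ (inj₂ i≡j)) → suc-injective i≡j })
... | no _  = countFin-≤2 (P ∘ suc) (P? ∘ suc) λ i j k p q q′ →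
                Sum.map suc-injective (Sum.map suc-injective suc-injective)
                  (no-three (suc i) (suc j) (suc k) p q q′)

module _ {r : ℕ} (S : Star n r) {u : Vertex n} where

  centre-neighbour-sees-no-leaf : 3 ≤ n → FQAdj u (center S) → adjLeaves S u ≡ 0
  centre-neighbour-sees-no-leaf 3≤n u~c =
    countFin-none _ (λ i → FQAdj? u (leaf S i)) (λ i → triangle-free 3≤n u~c (leaf-adj S i))

  adjLeaves-≤2 : 3 < n → u ≢ center S → adjLeaves S u ≤ 2
  adjLeaves-≤2 3<n u≢c = countFin-≤2 _ (λ i → FQAdj? u (leaf S i)) λ i j k u~i u~j u~k →
    Sum.map (leaf-inj S i j) (Sum.map (leaf-inj S i k) (leaf-inj S j k))
      (at-most-two-common-neighbours 3<n u≢c u~i (leaf-adj S i) u~j (leaf-adj S j) u~k (leaf-adj S k))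

lemma5p3 : (n r : ℕ) → 4 ≤ n → 2 ≤ r → r ≤ n + 1 →
    (S : Star n r) (u : Vertex n) → ¬ InStar S u →
    (nbrsInStar S u ≤ 2) × ((nbrsInStar S u ≡ 2) ⇔ (adjLeaves S u ≡ 2))
lemma5p3 n r 3<n _ _ S u u∉S with FQAdj? u (center S)
... | yes u~c rewrite centre-neighbour-sees-no-leaf S (<⇒≤ 3<n) u~c = s≤s z≤n , mk⇔ (λ ()) (λ ())
... | no _ = adjLeaves-≤2 S 3<n (u∉S ∘ inj₁) , mk⇔ id id
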